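{- Let $n\ge 2$ be an integer, let $a_1=0$ and let $a_2,\ldots,a_m$ be positive integers, with $a_1,\ldots,a_m$ pairwise distinct. Let $F=\{f_i(x)=nx+a_i \mid i=1,\ldots,m\}$. Then the $n$-ary number system $A=\{a_1,\ldots,a_m\}$ has the uniqueness property if and only if $F$ is a free semigroup basis.
   Context: For an integer $k\ge 0$, an $A$-expansion of $k$ is a tuple of digits $(\alpha_0,\ldots,\alpha_J)$ with all $\alpha_j\in A$, such that $k=\sum_{j=0}^J \alpha_j n^j$ and $\alpha_J\neq 0$; for $k=0$ the empty tuple is its $A$-expansion. The $n$-ary system $A$ has the uniqueness property if every integer $k\ge 0$ has at most one $A$-expansion. The set $F$ (of affine maps under composition) is a free semigroup basis if there is no nontrivial relation $f_{u_1}\circ\cdots\circ f_{u_p}=f_{v_1}\circ\cdots\circ f_{v_q}$ with $u_i,v_j\in\{1,\ldots,m\}$, $p,q\ge 1$ and $(u_1,\ldots,u_p)\neq(v_1,\ldots,v_q)$. -}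

module Defs where

open import Data.Nat using (ℕ; zero; suc; _+_; _*_; _≥_; _>_)
open import Data.Fin using (Fin)
open import Data.List using (List; []; _∷_; last)
open import Data.List.Relation.Unary.All using (All)
open import Data.List.Membership.Propositional using (_∈_)
open import Data.Maybe using (Maybe; just; nothing)
open import Data.Integer as ℤ using (ℤ; +_)
open import Data.Product using (_×_; Σ; ∃)
open import Relation.Binary.PropositionalEquality using (_≡_; _≢_)
open import Relation.Nullary using (¬_)

value : ℕ → List ℕ → ℕ
value n []       = 0
value n (α ∷ αs) = α + n * value n αs

LastNonzero : List ℕ → Set
LastNonzero αs = ∀ α → last αs ≡ just α → α ≢ 0

IsExpansion : ℕ → List ℕ → ℕ → List ℕ → Set
IsExpansion n A k αs = All (_∈ A) αs × LastNonzero αs × value n αs ≡ k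

UniquenessProperty : ℕ → List ℕ → Set
UniquenessProperty n A =
  ∀ k αs βs → IsExpansion n A k αs → IsExpansion n A k βs → αs ≡ βs

f : ℕ → ℕ → ℤ → ℤ
f n aᵢ x = (+ n) ℤ.* x ℤ.+ (+ aᵢ)

compose : ∀ {m} → ℕ → (Fin m → ℕ) → List (Fin m) → ℤ → ℤ
compose n a []       x = x
compose n a (u ∷ us) x = f n (a u) (compose n a us x)

FreeSemigroupBasis : ∀ {m} → ℕ → (Fin m → ℕ) → Set
FreeSemigroupBasis n a =
  ∀ (us vs : List (Fin _)) → us ≢ [] → vs ≢ [] →
  (∀ x → compose n a us x ≡ compose n a vs x) → us ≡ vs

-- The word u₁ ⋯ u_p acts as x ↦ nᵖ x + Σⱼ a_{u_{j+1}} nʲ, so two words define the same map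
-- iff they have the same length and the same value as digit strings. Since a₁ = 0, appending
-- the digit a₁ changes neither the value nor the string with its trailing zeros removed.
-- Uniqueness ⇒ freeness: words defining the same map give digit strings of equal length and
-- value; with trailing zeros removed these are expansions of the same integer, hence equal,
-- and equal length then forces the strings themselves to be equal.
-- Freeness ⇒ uniqueness: pad two expansions of k with the digit a₁ to a common nonzero
-- length; the padded words define the same map, hence coincide, and removing the padding
-- recovers the two expansions.
module Submission where

open import Defs
open import Data.Nat using (ℕ; suc; _≥_; _>_)
open import Data.Fin using (Fin; zero; suc)
open import Data.List using (List)
open import Data.Vec.Functional using (toList)
open import Function.Definitions using (Injective)
open import Function.Bundles using (_⇔_)
open import Relation.Binary.PropositionalEquality using (_≡_)

open import Data.Nat as ℕ using (_≤_; _<_; _^_; _∸_)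
import Data.Nat.Properties as ℕ
open import Data.Integer as ℤ using (+_; 0ℤ; 1ℤ)
import Data.Integer.Properties as ℤ
open import Data.Integer.Tactic.RingSolver using (solve-∀)
open import Data.List as List using ([]; _∷_; map; length; replicate; _++_; tabulate)
import Data.List.Properties as List
open import Data.List.Relation.Unary.All as All using (All; []; _∷_)
open import Data.List.Relation.Unary.All.Properties using (map⁺)
open import Data.List.Membership.Propositional using (_∈_)
open import Data.List.Membership.Propositional.Properties using (∈-tabulate⁺; ∈-tabulate⁻)
open import Data.Product using (_×_; _,_; ∃)
open import Function.Base using (_∘_)
open import Function.Bundles using (mk⇔; Equivalence)
open import Relation.Binary.Definitions using (tri<; tri≈; tri>)
open import Relation.Binary.PropositionalEquality
  using (refl; sym; trans; cong; cong₂; _≢_; module ≡-Reasoning)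
open import Relation.Nullary using (contradiction)

^-injectiveʳ : ∀ {n} → 1 < n → Injective _≡_ _≡_ (n ^_)
^-injectiveʳ {n} 1<n {p} {q} nᵖ≡nᵠ with ℕ.<-cmp p q
... | tri< p<q _ _ = contradiction nᵖ≡nᵠ (ℕ.<⇒≢ (ℕ.^-monoʳ-< n 1<n p<q))
... | tri≈ _ p≡q _ = p≡q
... | tri> _ _ q<p = contradiction (sym nᵖ≡nᵠ) (ℕ.<⇒≢ (ℕ.^-monoʳ-< n 1<n q<p))

affine-coefficients : ∀ p v q w → (∀ x → p ℤ.* x ℤ.+ v ≡ q ℤ.* x ℤ.+ w) → p ≡ q × v ≡ w
affine-coefficients p v q w pv≗qw = p≡q , v≡w
  where
  open ≡-Reasoning
  at0 : ∀ p v → v ≡ p ℤ.* 0ℤ ℤ.+ v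
  at0 = solve-∀
  at1 : ∀ p v → p ≡ p ℤ.* 1ℤ ℤ.+ v ℤ.- v
  at1 = solve-∀
  v≡w : v ≡ w
  v≡w = trans (at0 p v) (trans (pv≗qw 0ℤ) (sym (at0 q w)))
  p≡q : p ≡ q
  p≡q = begin
    p                     ≡⟨ at1 p v ⟩
    p ℤ.* 1ℤ ℤ.+ v ℤ.- v  ≡⟨ cong₂ ℤ._-_ (pv≗qw 1ℤ) v≡w ⟩
    q ℤ.* 1ℤ ℤ.+ w ℤ.- w  ≡⟨ sym (at1 q w) ⟩
    q                     ∎

module _ {m} (n : ℕ) (a : Fin m → ℕ) where

  compose-closed : ∀ us x →
    compose n a us x ≡ + (n ^ length us) ℤ.* x ℤ.+ + value n (map a us)
  compose-closed []       x = identity x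
    where
    identity : ∀ x → x ≡ 1ℤ ℤ.* x ℤ.+ 0ℤ
    identity = solve-∀
  compose-closed (u ∷ us) x = begin
    + n ℤ.* compose n a us x ℤ.+ + a u
      ≡⟨ cong (λ y → + n ℤ.* y ℤ.+ + a u) (compose-closed us x) ⟩
    + n ℤ.* (+ P ℤ.* x ℤ.+ + V) ℤ.+ + a u
      ≡⟨ regroup (+ n) (+ P) x (+ V) (+ a u) ⟩
    + n ℤ.* + P ℤ.* x ℤ.+ (+ a u ℤ.+ + n ℤ.* + V)
      ≡⟨ sym (cong₂ (λ c d → c ℤ.* x ℤ.+ d) (ℤ.pos-* n P)
               (trans (ℤ.pos-+ (a u) (n ℕ.* V)) (cong (ℤ._+_ (+ a u)) (ℤ.pos-* n V)))) ⟩
    + (n ℕ.* P) ℤ.* x ℤ.+ + (a u ℕ.+ n ℕ.* V)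
      ∎
    where
    open ≡-Reasoning
    P = n ^ length us
    V = value n (map a us)
    regroup : ∀ c p x v d → c ℤ.* (p ℤ.* x ℤ.+ v) ℤ.+ d ≡ c ℤ.* p ℤ.* x ℤ.+ (d ℤ.+ c ℤ.* v)
    regroup = solve-∀

  compose-≗⇔ : 1 < n → ∀ us vs →
    (∀ x → compose n a us x ≡ compose n a vs x) ⇔
    (length us ≡ length vs × value n (map a us) ≡ value n (map a vs))
  compose-≗⇔ 1<n us vs = mk⇔ to from
    where
    to : (∀ x → compose n a us x ≡ compose n a vs x) →
         length us ≡ length vs × value n (map a us) ≡ value n (map a vs)
    to us≗vs with affine-coefficients _ _ _ _
                    (λ x → trans (sym (compose-closed us x)) (trans (us≗vs x) (compose-closed vs x)))
    ... | P≡Q , V≡W = ^-injectiveʳ 1<n (ℤ.+-injective P≡Q) , ℤ.+-injective V≡W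
    from : length us ≡ length vs × value n (map a us) ≡ value n (map a vs) →
           ∀ x → compose n a us x ≡ compose n a vs x
    from (l≡l , v≡v) x = begin
      compose n a us x                                    ≡⟨ compose-closed us x ⟩
      + (n ^ length us) ℤ.* x ℤ.+ + value n (map a us)
        ≡⟨ cong₂ (λ l v → + (n ^ l) ℤ.* x ℤ.+ + v) l≡l v≡v ⟩
      + (n ^ length vs) ℤ.* x ℤ.+ + value n (map a vs)   ≡⟨ sym (compose-closed vs x) ⟩
      compose n a vs x                                    ∎
      where open ≡-Reasoning

-- Digits are listed from α₀ upward, so trailing zeros are the most significant ones;
-- x ∷₀ ys is x ∷ ys except that a zero is dropped when it would become the last digit.
infixr 5 _∷₀_

_∷₀_ : ℕ → List ℕ → List ℕ
x       ∷₀ (y ∷ ys) = x ∷ y ∷ ys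
ℕ.zero  ∷₀ []       = []
suc x   ∷₀ []       = suc x ∷ []

trim : List ℕ → List ℕ
trim []       = []
trim (x ∷ xs) = x ∷₀ trim xs

All-∷₀ : ∀ {p} {P : ℕ → Set p} {x ys} → P x → All P ys → All P (x ∷₀ ys)
All-∷₀ {ys = _ ∷ _}       px pys = px ∷ pys
All-∷₀ {x = ℕ.zero} {[]}  px pys = []
All-∷₀ {x = suc _}  {[]}  px pys = px ∷ []

All-trim : ∀ {p} {P : ℕ → Set p} {xs} → All P xs → All P (trim xs)
All-trim []         = []
All-trim (px ∷ pxs) = All-∷₀ px (All-trim pxs)

LastNonzero-∷₀ : ∀ x ys → LastNonzero ys → LastNonzero (x ∷₀ ys)
LastNonzero-∷₀ x       (_ ∷ _) last≢0 = last≢0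
LastNonzero-∷₀ ℕ.zero  []      _ _ ()
LastNonzero-∷₀ (suc _) []      _ _ refl ()

LastNonzero-trim : ∀ xs → LastNonzero (trim xs)
LastNonzero-trim []       _ ()
LastNonzero-trim (x ∷ xs) = LastNonzero-∷₀ x (trim xs) (LastNonzero-trim xs)

trim-fixes-LastNonzero : ∀ {xs} → LastNonzero xs → trim xs ≡ xs
trim-fixes-LastNonzero {[]}          _      = refl
trim-fixes-LastNonzero {ℕ.zero ∷ []} last≢0 = contradiction refl (last≢0 0 refl)
trim-fixes-LastNonzero {suc _ ∷ []}  _      = refl
trim-fixes-LastNonzero {x ∷ y ∷ ys}  last≢0 = cong (x ∷₀_) (trim-fixes-LastNonzero {y ∷ ys} last≢0)

trim-++-zeros : ∀ xs d → trim (xs ++ replicate d 0) ≡ trim xs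
trim-++-zeros []       ℕ.zero  = refl
trim-++-zeros []       (suc d) = cong (0 ∷₀_) (trim-++-zeros [] d)
trim-++-zeros (x ∷ xs) d       = cong (x ∷₀_) (trim-++-zeros xs d)

∷₀-padding : ∀ x ys d → ∃ λ e → x ∷ ys ++ replicate d 0 ≡ (x ∷₀ ys) ++ replicate e 0
∷₀-padding x       (_ ∷ _) d = d , refl
∷₀-padding ℕ.zero  []      d = suc d , refl
∷₀-padding (suc _) []      d = d , refl

trim-padding : ∀ xs → ∃ λ d → xs ≡ trim xs ++ replicate d 0
trim-padding []       = 0 , refl
trim-padding (x ∷ xs) with trim-padding xs
... | d , xs≡ with ∷₀-padding x (trim xs) d
...   | e , x∷xs≡ = e , trans (cong (x ∷_) xs≡) x∷xs≡

value-++-zeros : ∀ n xs d → value n (xs ++ replicate d 0) ≡ value n xs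
value-++-zeros n []       ℕ.zero  = refl
value-++-zeros n []       (suc d) = trans (cong (n ℕ.*_) (value-++-zeros n [] d)) (ℕ.*-zeroʳ n)
value-++-zeros n (x ∷ xs) d       = cong (λ v → x ℕ.+ n ℕ.* v) (value-++-zeros n xs d)

value-trim : ∀ n xs → value n (trim xs) ≡ value n xs
value-trim n xs with trim-padding xs
... | d , xs≡ = sym (trans (cong (value n) xs≡) (value-++-zeros n (trim xs) d))

trim-injective : ∀ {xs ys} → trim xs ≡ trim ys → length xs ≡ length ys → xs ≡ ys
trim-injective {xs} {ys} trim≡ |xs|≡|ys| with trim-padding xs | trim-padding ys
... | d , xs≡ | e , ys≡ = begin
  xs                         ≡⟨ xs≡ ⟩
  trim xs ++ replicate d 0   ≡⟨ cong₂ (λ t k → t ++ replicate k 0) trim≡ d≡e ⟩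
  trim ys ++ replicate e 0   ≡⟨ sym ys≡ ⟩
  ys                         ∎
  where
  open ≡-Reasoning
  length-padded : ∀ ts k → length (ts ++ replicate k 0) ≡ length ts ℕ.+ k
  length-padded ts k = trans (List.length-++ ts) (cong (length ts ℕ.+_) (List.length-replicate k))
  d≡e : d ≡ e
  d≡e = ℕ.+-cancelˡ-≡ (length (trim xs)) d e (begin
    length (trim xs) ℕ.+ d             ≡⟨ sym (length-padded (trim xs) d) ⟩
    length (trim xs ++ replicate d 0)  ≡⟨ cong length (sym xs≡) ⟩
    length xs                          ≡⟨ |xs|≡|ys| ⟩
    length ys                          ≡⟨ cong length ys≡ ⟩
    length (trim ys ++ replicate e 0)  ≡⟨ length-padded (trim ys) e ⟩
    length (trim ys) ℕ.+ e             ≡⟨ cong (ℕ._+ e) (sym (cong length trim≡)) ⟩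
    length (trim xs) ℕ.+ e             ∎)

trim-IsExpansion : ∀ {n A k xs} → All (_∈ A) xs → value n xs ≡ k → IsExpansion n A k (trim xs)
trim-IsExpansion {n} {xs = xs} xs∈A value≡k =
  All-trim xs∈A , LastNonzero-trim xs , trans (value-trim n xs) value≡k

module _ {m} (a : Fin m → ℕ) where

  All-∈-tabulate : ∀ us → All (_∈ tabulate a) (map a us)
  All-∈-tabulate us = map⁺ (All.universal (∈-tabulate⁺ {f = a}) us)

  All-∈-tabulate⁻ : ∀ {αs} → All (_∈ tabulate a) αs → ∃ λ us → map a us ≡ αs
  All-∈-tabulate⁻ []          = [] , refl
  All-∈-tabulate⁻ (α∈ ∷ αs∈) with ∈-tabulate⁻ α∈ | All-∈-tabulate⁻ αs∈
  ... | i , refl | us , refl = i ∷ us , refl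

  module Padding (z : Fin m) (a[z]≡0 : a z ≡ 0) (L : ℕ) where

    padTo : List (Fin m) → List (Fin m)
    padTo us = us ++ replicate (L ∸ length us) z

    length-padTo : ∀ us → length us ≤ L → length (padTo us) ≡ L
    length-padTo us |us|≤L = begin
      length (us ++ replicate (L ∸ length us) z)  ≡⟨ List.length-++ us ⟩
      length us ℕ.+ length (replicate (L ∸ length us) z)
        ≡⟨ cong (length us ℕ.+_) (List.length-replicate (L ∸ length us)) ⟩
      length us ℕ.+ (L ∸ length us)              ≡⟨ ℕ.m+[n∸m]≡n |us|≤L ⟩
      L                                           ∎
      where open ≡-Reasoning

    map-padTo : ∀ us → map a (padTo us) ≡ map a us ++ replicate (L ∸ length us) 0
    map-padTo us = trans (List.map-++ a us _)
      (cong (map a us ++_) (trans (List.map-replicate a _ z) (cong (replicate _) a[z]≡0)))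

    trim-padTo : ∀ us → trim (map a (padTo us)) ≡ trim (map a us)
    trim-padTo us = trans (cong trim (map-padTo us)) (trim-++-zeros (map a us) _)

    padTo-nonempty : ∀ us → length us ≤ L → .{{_ : ℕ.NonZero L}} → padTo us ≢ []
    padTo-nonempty us |us|≤L padTo≡[] =
      ℕ.≢-nonZero⁻¹ L (trans (sym (length-padTo us |us|≤L)) (cong length padTo≡[]))

    padTo-≗ : ∀ n → 1 < n → ∀ us vs → length us ≤ L → length vs ≤ L →
      value n (map a us) ≡ value n (map a vs) →
      ∀ x → compose n a (padTo us) x ≡ compose n a (padTo vs) x
    padTo-≗ n 1<n us vs |us|≤L |vs|≤L value≡ =
      Equivalence.from (compose-≗⇔ n a 1<n (padTo us) (padTo vs))
        (trans (length-padTo us |us|≤L) (sym (length-padTo vs |vs|≤L)) , (begin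
          value n (map a (padTo us)) ≡⟨ value-padTo us ⟩
          value n (map a us)         ≡⟨ value≡ ⟩
          value n (map a vs)         ≡⟨ sym (value-padTo vs) ⟩
          value n (map a (padTo vs)) ∎))
      where
      open ≡-Reasoning
      value-padTo : ∀ us → value n (map a (padTo us)) ≡ value n (map a us)
      value-padTo us = trans (cong (value n) (map-padTo us)) (value-++-zeros n (map a us) _)

proposition1 : (n m : ℕ) → n ≥ 2 → (a : Fin (suc m) → ℕ) →
    a zero ≡ 0 → (∀ (i : Fin m) → a (suc i) > 0) → Injective _≡_ _≡_ a →
    UniquenessProperty n (toList a) ⇔ FreeSemigroupBasis n a
proposition1 n m 1<n a a[0]≡0 _ a-injective = mk⇔ unique⇒free free⇒unique
  where
  unique⇒free : UniquenessProperty n (toList a) → FreeSemigroupBasis n a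
  unique⇒free unique us vs _ _ us≗vs with Equivalence.to (compose-≗⇔ n a 1<n us vs) us≗vs
  ... | |us|≡|vs| , value≡ = List.map-injective a-injective (trim-injective
    (unique _ _ _ (trim-IsExpansion (All-∈-tabulate a us) refl)
                  (trim-IsExpansion (All-∈-tabulate a vs) (sym value≡)))
    (trans (List.length-map a us) (trans |us|≡|vs| (sym (List.length-map a vs)))))

  free⇒unique : FreeSemigroupBasis n a → UniquenessProperty n (toList a)
  free⇒unique free k _ _ (us∈ , us-last , us-value) (vs∈ , vs-last , vs-value)
    with All-∈-tabulate⁻ a us∈ | All-∈-tabulate⁻ a vs∈
  ... | us , refl | vs , refl = begin
    map a us                  ≡⟨ sym (trim-fixes-LastNonzero us-last) ⟩
    trim (map a us)           ≡⟨ sym (trim-padTo us) ⟩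
    trim (map a (padTo us))   ≡⟨ cong (trim ∘ map a) padTo-us≡vs ⟩
    trim (map a (padTo vs))   ≡⟨ trim-padTo vs ⟩
    trim (map a vs)           ≡⟨ trim-fixes-LastNonzero vs-last ⟩
    map a vs                  ∎
    where
    open ≡-Reasoning
    L : ℕ
    L = suc (length us ℕ.+ length vs)
    open Padding a zero a[0]≡0 L
    |us|≤L : length us ≤ L
    |us|≤L = ℕ.m≤n⇒m≤1+n (ℕ.m≤m+n (length us) (length vs))
    |vs|≤L : length vs ≤ L
    |vs|≤L = ℕ.m≤n⇒m≤1+n (ℕ.m≤n+m (length vs) (length us))
    padTo-us≡vs : padTo us ≡ padTo vs
    padTo-us≡vs = free (padTo us) (padTo vs) (padTo-nonempty us |us|≤L) (padTo-nonempty vs |vs|≤L)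
      (padTo-≗ n 1<n us vs |us|≤L |vs|≤L (trans us-value (sym vs-value)))
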